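{- Let $G=(V,E)$ be a graph with positive edge lengths, let $r>0$, and let $\mathrm{SPC}(r)\subseteq V$ be a shortest path cover for scale $r$. Let $\mathcal{T}$ be the set of clusters for $r$ and $\mathrm{SPC}(r)$. Then every non-cluster vertex $v$ satisfies $\mathrm{dist}_G(v,\mathrm{SPC}(r))\le r$; every cluster $T\in\mathcal{T}$ has diameter at most $r$; and $\mathrm{dist}_G(T,T')>2r$ for every pair of distinct clusters $T,T'\in\mathcal{T}$.
   Context: $\mathrm{dist}_G(u,v)$ is the shortest-path distance in $G$; for sets $S,S'$, $\mathrm{dist}_G(u,S)=\min_{v\in S}\mathrm{dist}_G(u,v)$ and $\mathrm{dist}_G(S,S')=\min_{v\in S}\mathrm{dist}_G(v,S')$. A shortest path cover $\mathrm{SPC}(r)\subseteq V$ for scale $r$ is a set of vertices intersecting the vertex set of every shortest path of $G$ of length more than $r$ and at most $2r$. A cluster is an inclusion-wise maximal set $T\subseteq\{v\in V\mid \mathrm{dist}_G(v,\mathrm{SPC}(r))>r\}$ such that $\mathrm{dist}_G(u,w)\le r$ for all $u,w\in T$; $\mathcal{T}$ denotes the set of all clusters, and non-cluster vertices are those in no cluster of $\mathcal{T}$.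
   Formalization: The edge lengths and the scale $r$ are taken in the positive rationals instead of the positive reals. -}

module Defs where

open import Data.Nat using (ℕ)
open import Data.Fin using (Fin)
open import Data.Fin.Subset using (Subset; _∈_; _∉_; _⊆_)
open import Data.List using (List; []; _∷_)
open import Data.List.Relation.Unary.All using (All)
import Data.List.Membership.Propositional as LM
open import Data.Product using (_×_; _,_; Σ; ∃; ∃-syntax)
open import Data.Sum using (_⊎_)
open import Data.Rational using (ℚ; 0ℚ; _+_; _<_; _≤_)
open import Relation.Nullary using (¬_)
open import Relation.Binary.PropositionalEquality using (_≡_)

-- An edge (u , v , ℓ) is an undirected edge between u and v of length ℓ.
Edge : ℕ → Set
Edge n = Fin n × Fin n × ℚ

edgeLength : ∀ {n} → Edge n → ℚ
edgeLength (_ , _ , ℓ) = ℓ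

record Graph (n : ℕ) : Set where
  field
    edges    : List (Edge n)
    positive : All (λ e → 0ℚ < edgeLength e) edges
open Graph public

Adj : ∀ {n} → Graph n → Fin n → Fin n → ℚ → Set
Adj G u v ℓ = LM._∈_ (u , v , ℓ) (edges G) ⊎ LM._∈_ (v , u , ℓ) (edges G)

data Walk {n : ℕ} (G : Graph n) : Fin n → Fin n → Set where
  []  : ∀ {u} → Walk G u u
  _∷_ : ∀ {u v w ℓ} → Adj G u v ℓ → Walk G v w → Walk G u w

len : ∀ {n} {G : Graph n} {u w} → Walk G u w → ℚ
len [] = 0ℚ
len (_∷_ {ℓ = ℓ} _ p) = ℓ + len p

verts : ∀ {n} {G : Graph n} {u w} → Walk G u w → List (Fin n)
verts {u = u} [] = u ∷ []
verts {u = u} (_ ∷ p) = u ∷ verts p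

IsShortest : ∀ {n} {G : Graph n} {u w} → Walk G u w → Set
IsShortest {G = G} {u} {w} P = (Q : Walk G u w) → len P ≤ len Q

-- dist_G(u,v) ≤ d  (dist_G is the minimum length of a u-v walk; +∞ if none).
DistLe : ∀ {n} → Graph n → Fin n → Fin n → ℚ → Set
DistLe G u v d = Σ (Walk G u v) (λ P → len P ≤ d)

DistSetLe : ∀ {n} → Graph n → Fin n → Subset n → ℚ → Set
DistSetLe G v S d = ∃[ s ] (s ∈ S × DistLe G v s d)

DistSetGt : ∀ {n} → Graph n → Fin n → Subset n → ℚ → Set
DistSetGt G v S d = ∀ s → s ∈ S → ¬ DistLe G v s d

SetDistGt : ∀ {n} → Graph n → Subset n → Subset n → ℚ → Set
SetDistGt G T T' d = ∀ u w → u ∈ T → w ∈ T' → ¬ DistLe G u w d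

DiamLe : ∀ {n} → Graph n → Subset n → ℚ → Set
DiamLe G T d = ∀ u w → u ∈ T → w ∈ T → DistLe G u w d

IsSPC : ∀ {n} → Graph n → ℚ → Subset n → Set
IsSPC G r S = ∀ u w (P : Walk G u w) → IsShortest P → r < len P → len P ≤ r + r →
  ∃[ x ] (LM._∈_ x (verts P) × x ∈ S)

Admissible : ∀ {n} → Graph n → ℚ → Subset n → Subset n → Set
Admissible G r S T = (∀ v → v ∈ T → DistSetGt G v S r) × DiamLe G T r

IsCluster : ∀ {n} → Graph n → ℚ → Subset n → Subset n → Set
IsCluster G r S T = Admissible G r S T × (∀ T' → T ⊆ T' → Admissible G r S T' → T' ≡ T)

NonCluster : ∀ {n} → Graph n → ℚ → Subset n → Fin n → Set
NonCluster G r S v = ¬ (∃[ T ] (IsCluster G r S T × v ∈ T))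

-- For vertices u, w at distance more than r from SPC(r), dist(u, w) ≤ 2r already forces
-- dist(u, w) ≤ r: a shortest u–w path longer than r is hit by SPC(r) at some x, and then
-- dist(u, x) > r and dist(x, w) > r make the path longer than 2r. With this gap, two clusters
-- within 2r of each other have an admissible union, so by maximality they coincide; and a
-- vertex v far from SPC(r) lies in the cluster {w far from SPC(r) | dist(v, w) ≤ r}.
-- Constructively, distances are decidable and shortest walks exist because every walk
-- shortens to a path, and the paths (at most n vertices) can be enumerated.
module Submission where

open import Defs
open import Data.Nat using (ℕ)
open import Data.Fin using (Fin)
open import Data.Fin.Subset using (Subset)
open import Data.Product using (_×_)
open import Data.Rational using (ℚ; 0ℚ; _+_; _<_)
open import Relation.Nullary using (¬_)
open import Relation.Binary.PropositionalEquality using (_≡_)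

import Data.Nat as ℕ
open import Data.Empty using (⊥-elim)
open import Data.Fin using (zero; suc)
open import Data.Fin.Properties using (_≟_; any?; injective⇒≤)
open import Data.Fin.Subset using (_∈_; _⊆_; _∪_)
open import Data.Fin.Subset.Properties using (⊆-antisym; p⊆p∪q; q⊆p∪q; x∈p∪q⁻; _∈?_)
open import Data.List using (List; []; _∷_; _++_; map; concatMap; length; lookup)
open import Data.List.Membership.Propositional using (mapWith∈; lose) renaming (_∈_ to _∈ᴸ_)
import Data.List.Membership.DecPropositional as DecMembership
open import Data.List.Membership.Propositional.Properties
  using (∈-map⁺; ∈-++⁺ˡ; ∈-++⁺ʳ; ∈-concatMap⁺; ∈-lookup)
open import Data.List.Relation.Unary.All as All using (All)
open import Data.List.Relation.Unary.All.Properties using (¬Any⇒All¬)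
open import Data.List.Relation.Unary.Any as Any using (Any; here; there)
open import Data.List.Relation.Unary.Any.Properties using (mapWith∈⁺)
open import Data.List.Relation.Unary.AllPairs using ([]; _∷_)
open import Data.List.Relation.Unary.Unique.Propositional using (Unique)
open import Data.Product using (Σ; ∃; ∃₂; _,_; proj₁; proj₂)
open import Data.Rational using (_≤_; _≤?_)
open import Data.Rational.Properties
  using (≤-decTotalOrder; ≤-refl; ≤-trans; <⇒≤; ≰⇒>; <-≤-trans; <-irrefl;
         +-identityˡ; +-identityʳ; +-assoc; +-comm; +-mono-≤; +-monoʳ-≤; +-mono-<)
open import Data.Sum using (inj₁; inj₂; [_,_]′)
open import Data.Vec using (tabulate)
open import Data.Vec.Properties using (lookup∘tabulate; []=⇒lookup; lookup⇒[]=)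
open import Function using (_∘_)
open import Relation.Nullary using (Dec; yes; no; does; ¬?; contradiction)
open import Relation.Nullary.Decidable using (map′; _×-dec_; dec-true)
open import Relation.Binary.Bundles using (DecTotalOrder)
open import Relation.Binary.PropositionalEquality
  using (refl; sym; trans; cong; cong₂; subst; module ≡-Reasoning)
open import Data.List.Extrema (DecTotalOrder.totalOrder ≤-decTotalOrder)
  using (argmin; f[argmin]≤f[⊤]; f[argmin]≤f[xs])

unique⇒lookup-injective : ∀ {A : Set} {xs : List A} → Unique xs →
  ∀ i j → lookup xs i ≡ lookup xs j → i ≡ j
unique⇒lookup-injective (_ ∷ _) zero zero _ = refl
unique⇒lookup-injective (x∉xs ∷ _) zero (suc j) eq =
  contradiction eq (All.lookup x∉xs (∈-lookup j))
unique⇒lookup-injective (x∉xs ∷ _) (suc i) zero eq =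
  contradiction (sym eq) (All.lookup x∉xs (∈-lookup i))
unique⇒lookup-injective (_ ∷ u) (suc i) (suc j) eq = cong suc (unique⇒lookup-injective u i j eq)

unique⇒length≤ : ∀ {n} {xs : List (Fin n)} → Unique xs → length xs ℕ.≤ n
unique⇒length≤ u = injective⇒≤ (unique⇒lookup-injective u _ _)

module _ {n : ℕ} {P : Fin n → Set} where

  select : (∀ x → Dec (P x)) → Subset n
  select P? = tabulate (does ∘ P?)

  select⁻ : ∀ P? {x} → x ∈ select P? → P x
  select⁻ P? {x} x∈ with P? x | trans (sym (lookup∘tabulate (does ∘ P?) x)) ([]=⇒lookup x∈)
  ... | yes px | _ = px
  ... | no _   | ()

  select⁺ : ∀ P? {x} → P x → x ∈ select P?
  select⁺ P? {x} px = lookup⇒[]= x _ (trans (lookup∘tabulate (does ∘ P?) x) (dec-true (P? x) px))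

module _ {n : ℕ} (G : Graph n) where

  private variable
    u v w x : Fin n
    ℓ d : ℚ

  adj-positive : Adj G u v ℓ → 0ℚ < ℓ
  adj-positive (inj₁ e∈) = All.lookup (positive G) e∈
  adj-positive (inj₂ e∈) = All.lookup (positive G) e∈

  adj-sym : Adj G u v ℓ → Adj G v u ℓ
  adj-sym (inj₁ e∈) = inj₂ e∈
  adj-sym (inj₂ e∈) = inj₁ e∈

  _++ʷ_ : Walk G u v → Walk G v w → Walk G u w
  [] ++ʷ q = q
  (a ∷ p) ++ʷ q = a ∷ (p ++ʷ q)

  reverseʷ : Walk G u w → Walk G w u
  reverseʷ [] = []
  reverseʷ (a ∷ p) = reverseʷ p ++ʷ (adj-sym a ∷ [])

  len-++ : (p : Walk G u v) (q : Walk G v w) → len (p ++ʷ q) ≡ len p + len q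
  len-++ [] q = sym (+-identityˡ (len q))
  len-++ (_∷_ {ℓ = ℓ} _ p) q = trans (cong (ℓ +_) (len-++ p q)) (sym (+-assoc ℓ (len p) (len q)))

  len-reverse : (p : Walk G u w) → len (reverseʷ p) ≡ len p
  len-reverse [] = refl
  len-reverse (_∷_ {ℓ = ℓ} a p) = begin
    len (reverseʷ p ++ʷ (adj-sym a ∷ [])) ≡⟨ len-++ (reverseʷ p) (adj-sym a ∷ []) ⟩
    len (reverseʷ p) + (ℓ + 0ℚ)           ≡⟨ cong₂ _+_ (len-reverse p) (+-identityʳ ℓ) ⟩
    len p + ℓ                             ≡⟨ +-comm (len p) ℓ ⟩
    ℓ + len p                             ∎
    where open ≡-Reasoning

  len-tail≤ : (a : Adj G u v ℓ) (p : Walk G v w) → len p ≤ len (a ∷ p)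
  len-tail≤ {ℓ = ℓ} a p = subst (_≤ ℓ + len p) (+-identityˡ (len p))
    (+-mono-≤ (<⇒≤ (adj-positive a)) (≤-refl {len p}))

  len-suffix≤ : (p : Walk G u v) (q : Walk G v w) → len q ≤ len (p ++ʷ q)
  len-suffix≤ [] q = ≤-refl
  len-suffix≤ (a ∷ p) q = ≤-trans (len-suffix≤ p q) (len-tail≤ a (p ++ʷ q))

  splitAt : (p : Walk G u w) → x ∈ᴸ verts p →
    ∃₂ λ (p₁ : Walk G u x) (p₂ : Walk G x w) → p ≡ p₁ ++ʷ p₂
  splitAt [] (here refl) = [] , [] , refl
  splitAt (a ∷ p) (here refl) = [] , a ∷ p , refl
  splitAt (a ∷ p) (there x∈p) with splitAt p x∈p
  ... | p₁ , p₂ , refl = a ∷ p₁ , p₂ , refl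

  IsPath : Walk G u w → Set
  IsPath p = Unique (verts p)

  suffix-isPath : (p : Walk G u v) (q : Walk G v w) → IsPath (p ++ʷ q) → IsPath q
  suffix-isPath [] q pq-path = pq-path
  suffix-isPath (a ∷ p) q (_ ∷ pq-path) = suffix-isPath p q pq-path

  open DecMembership (_≟_ {n}) using () renaming (_∈?_ to _∈ᴸ?_)

  toPath : (p : Walk G u w) → Σ (Walk G u w) λ q → len q ≤ len p × IsPath q
  toPath [] = [] , ≤-refl , All.[] ∷ []
  toPath {u} (_∷_ {ℓ = ℓ} a p) with toPath p
  ... | q , q≤p , q-path with u ∈ᴸ? verts q
  ...   | no u∉q = a ∷ q , +-monoʳ-≤ ℓ q≤p , ¬Any⇒All¬ (verts q) u∉q ∷ q-path
  -- loop erasure: u already lies on q, so keep only the part of q from u on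
  ...   | yes u∈q with splitAt q u∈q
  ...     | q₁ , q₂ , refl =
    q₂ , ≤-trans (len-suffix≤ q₁ q₂) (≤-trans q≤p (len-tail≤ a p)) , suffix-isPath q₁ q₂ q-path

  Arc : Set
  Arc = Σ (Edge n) λ (u , v , ℓ) → Adj G u v ℓ

  arcs : List Arc
  arcs = mapWith∈ (edges G) (λ {(u , v , ℓ)} e∈ → (u , v , ℓ) , inj₁ e∈)
      ++ mapWith∈ (edges G) (λ {(u , v , ℓ)} e∈ → (v , u , ℓ) , inj₂ e∈)

  ∈-arcs : (a : Adj G u v ℓ) → ((u , v , ℓ) , a) ∈ᴸ arcs
  ∈-arcs (inj₁ e∈) = ∈-++⁺ˡ (mapWith∈⁺ _ (_ , e∈ , refl))
  ∈-arcs (inj₂ e∈) = ∈-++⁺ʳ _ (mapWith∈⁺ _ (_ , e∈ , refl))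

  Step : Fin n → Set
  Step u = ∃₂ λ v ℓ → Adj G u v ℓ

  startingAt : (u : Fin n) → Arc → List (Step u)
  startingAt u ((a , v , ℓ) , adj) with a ≟ u
  ... | yes refl = (v , ℓ , adj) ∷ []
  ... | no _ = []

  ∈-startingAt : (a : Adj G u v ℓ) → (v , ℓ , a) ∈ᴸ startingAt u ((u , v , ℓ) , a)
  ∈-startingAt {u} a with u ≟ u
  ... | yes refl = here refl
  ... | no u≢u = contradiction refl u≢u

  stepsFrom : (u : Fin n) → List (Step u)
  stepsFrom u = concatMap (startingAt u) arcs

  ∈-stepsFrom : (a : Adj G u v ℓ) → (v , ℓ , a) ∈ᴸ stepsFrom u
  ∈-stepsFrom a = ∈-concatMap⁺ _ (lose (∈-arcs a) (∈-startingAt a))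

  trivialWalks : (u w : Fin n) → List (Walk G u w)
  trivialWalks u w with u ≟ w
  ... | yes refl = [] ∷ []
  ... | no _ = []

  []∈trivialWalks : [] ∈ᴸ trivialWalks u u
  []∈trivialWalks {u} with u ≟ u
  ... | yes refl = here refl
  ... | no u≢u = contradiction refl u≢u

  walksWithin : ℕ → (u w : Fin n) → List (Walk G u w)
  walksWithin ℕ.zero u w = []
  walksWithin (ℕ.suc k) u w =
    trivialWalks u w ++ concatMap (λ (v , _ , a) → map (a ∷_) (walksWithin k v w)) (stepsFrom u)

  ∈-walksWithin : ∀ {k} (p : Walk G u w) → length (verts p) ℕ.≤ k → p ∈ᴸ walksWithin k u w
  ∈-walksWithin {k = ℕ.zero} [] ()
  ∈-walksWithin {k = ℕ.zero} (_ ∷ _) ()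
  ∈-walksWithin {k = ℕ.suc k} [] _ = ∈-++⁺ˡ []∈trivialWalks
  ∈-walksWithin {u} {w} {k = ℕ.suc k} (a ∷ p) (ℕ.s≤s p≤k) = ∈-++⁺ʳ (trivialWalks u w)
    (∈-concatMap⁺ _ (lose (∈-stepsFrom a) (∈-map⁺ (a ∷_) (∈-walksWithin p p≤k))))

  candidates : (u w : Fin n) → List (Walk G u w)
  candidates = walksWithin n

  candidate≤ : (q : Walk G u w) → ∃ λ p → p ∈ᴸ candidates u w × len p ≤ len q
  candidate≤ q with toPath q
  ... | p , p≤q , p-path = p , ∈-walksWithin p (unique⇒length≤ p-path) , p≤q

  distLe? : ∀ u w d → Dec (DistLe G u w d)
  distLe? u w d = map′ Any.satisfied below (Any.any? (λ p → len p ≤? d) (candidates u w))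
    where
    below : DistLe G u w d → Any (λ p → len p ≤ d) (candidates u w)
    below (q , q≤d) with candidate≤ q
    ... | p , p∈ , p≤q = lose p∈ (≤-trans p≤q q≤d)

  shortest≤ : (q : Walk G u w) → Σ (Walk G u w) λ p → IsShortest p × len p ≤ len q
  shortest≤ {u} {w} q = p , p-shortest , f[argmin]≤f[⊤] {f = len} q (candidates u w)
    where
    p : Walk G u w
    p = argmin len q (candidates u w)
    p-shortest : IsShortest p
    p-shortest q′ with candidate≤ q′
    ... | c , c∈ , c≤q′ =
      ≤-trans (All.lookup (f[argmin]≤f[xs] {f = len} q (candidates u w)) c∈) c≤q′

  distLe-refl : 0ℚ ≤ d → DistLe G u u d
  distLe-refl 0≤d = [] , 0≤d

  distLe-sym : DistLe G u w d → DistLe G w u d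
  distLe-sym (p , p≤d) = reverseʷ p , subst (_≤ _) (sym (len-reverse p)) p≤d

  distLe-trans : ∀ {d′} → DistLe G u v d → DistLe G v w d′ → DistLe G u w (d + d′)
  distLe-trans (p , p≤d) (q , q≤d′) = p ++ʷ q , subst (_≤ _) (sym (len-++ p q)) (+-mono-≤ p≤d q≤d′)

  distSetLe? : ∀ v S d → Dec (DistSetLe G v S d)
  distSetLe? v S d = any? (λ s → (s ∈? S) ×-dec distLe? v s d)

  ¬distSetLe⇒distSetGt : ∀ {S} → ¬ DistSetLe G v S d → DistSetGt G v S d
  ¬distSetLe⇒distSetGt ¬le s s∈S vs = ¬le (s , s∈S , vs)

  distSetGt? : ∀ v S d → Dec (DistSetGt G v S d)
  distSetGt? v S d =
    map′ ¬distSetLe⇒distSetGt (λ { gt (s , s∈S , vs) → gt s s∈S vs }) (¬? (distSetLe? v S d))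

  distSetGt⇒<len : ∀ {S} → DistSetGt G u S d → x ∈ S → (p : Walk G u x) → d < len p
  distSetGt⇒<len u-far x∈S p = ≰⇒> λ p≤d → u-far _ x∈S (p , p≤d)

  diamLe-∪ : ∀ {T T′} → DiamLe G T d → DiamLe G T′ d →
    (∀ x y → x ∈ T → y ∈ T′ → DistLe G x y d) → DiamLe G (T ∪ T′) d
  diamLe-∪ {T = T} {T′} diamT diamT′ across x y x∈ y∈ with x∈p∪q⁻ T T′ x∈ | x∈p∪q⁻ T T′ y∈
  ... | inj₁ x∈T  | inj₁ y∈T  = diamT x y x∈T y∈T
  ... | inj₁ x∈T  | inj₂ y∈T′ = across x y x∈T y∈T′
  ... | inj₂ x∈T′ | inj₁ y∈T  = distLe-sym (across y x y∈T x∈T′)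
  ... | inj₂ x∈T′ | inj₂ y∈T′ = diamT′ x y x∈T′ y∈T′

  module Clustering (r : ℚ) (0<r : 0ℚ < r) (S : Subset n) (spc : IsSPC G r S) where

    Far : Fin n → Set
    Far v = DistSetGt G v S r

    far-ends⇒r+r<len : Far u → Far w → (p : Walk G u w) → x ∈ᴸ verts p → x ∈ S → r + r < len p
    far-ends⇒r+r<len far-u far-w p x∈p x∈S with splitAt p x∈p
    ... | p₁ , p₂ , refl = subst (r + r <_) (sym (len-++ p₁ p₂))
      (+-mono-< (distSetGt⇒<len far-u x∈S p₁)
                (subst (r <_) (len-reverse p₂) (distSetGt⇒<len far-w x∈S (reverseʷ p₂))))

    distLe-gap : Far u → Far w → DistLe G u w (r + r) → DistLe G u w r
    distLe-gap {u} {w} far-u far-w (q , q≤r+r) with shortest≤ q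
    ... | p , p-shortest , p≤q with len p ≤? r
    ...   | yes p≤r = p , p≤r
    ...   | no p≰r with spc u w p p-shortest (≰⇒> p≰r) (≤-trans p≤q q≤r+r)
    ...     | x , x∈p , x∈S = ⊥-elim (<-irrefl refl
              (<-≤-trans (far-ends⇒r+r<len far-u far-w p x∈p x∈S) (≤-trans p≤q q≤r+r)))

    ∪-admissible : ∀ {T T′} → Admissible G r S T → Admissible G r S T′ →
      u ∈ T → w ∈ T′ → DistLe G u w (r + r) → Admissible G r S (T ∪ T′)
    ∪-admissible {u} {w} {T} {T′} (farT , diamT) (farT′ , diamT′) u∈T w∈T′ uw≤r+r =
      far , diamLe-∪ diamT diamT′ across
      where
      far : ∀ v → v ∈ T ∪ T′ → Far v
      far v v∈ = [ farT v , farT′ v ]′ (x∈p∪q⁻ T T′ v∈)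
      uw≤r : DistLe G u w r
      uw≤r = distLe-gap (farT u u∈T) (farT′ w w∈T′) uw≤r+r
      across : ∀ x y → x ∈ T → y ∈ T′ → DistLe G x y r
      across x y x∈T y∈T′ = distLe-gap far-x far-y (distLe-trans xw≤r (diamT′ w y w∈T′ y∈T′))
        where
        far-x : Far x
        far-x = farT x x∈T
        far-y : Far y
        far-y = farT′ y y∈T′
        xw≤r : DistLe G x w r
        xw≤r = distLe-gap far-x (farT′ w w∈T′) (distLe-trans (diamT x u x∈T u∈T) uw≤r)

    clusters-far-apart : (T T′ : Subset n) → IsCluster G r S T → IsCluster G r S T′ → ¬ (T ≡ T′) →
      SetDistGt G T T′ (r + r)
    clusters-far-apart T T′ (admT , maxT) (admT′ , maxT′) T≢T′ u w u∈T w∈T′ uw≤r+r =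
      T≢T′ (trans (sym (maxT (T ∪ T′) (p⊆p∪q T′) adm)) (maxT′ (T ∪ T′) (q⊆p∪q T T′) adm))
      where
      adm : Admissible G r S (T ∪ T′)
      adm = ∪-admissible admT admT′ u∈T w∈T′ uw≤r+r

    far-near? : ∀ v w → Dec (Far w × DistLe G v w r)
    far-near? v w = distSetGt? w S r ×-dec distLe? v w r

    farBall : Fin n → Subset n
    farBall v = select (far-near? v)

    ∈-farBall⁻ : w ∈ farBall v → Far w × DistLe G v w r
    ∈-farBall⁻ {v = v} = select⁻ (far-near? v)

    ∈-farBall⁺ : Far w → DistLe G v w r → w ∈ farBall v
    ∈-farBall⁺ {v = v} far-w vw≤r = select⁺ (far-near? v) (far-w , vw≤r)

    farBall-admissible : Admissible G r S (farBall v)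
    farBall-admissible = (λ w w∈ → proj₁ (∈-farBall⁻ w∈)) , diam
      where
      diam : DiamLe G (farBall _) r
      diam x y x∈ y∈ with ∈-farBall⁻ x∈ | ∈-farBall⁻ y∈
      ... | far-x , vx≤r | far-y , vy≤r =
        distLe-gap far-x far-y (distLe-trans (distLe-sym vx≤r) vy≤r)

    center∈farBall : Far v → v ∈ farBall v
    center∈farBall far-v = ∈-farBall⁺ far-v (distLe-refl (<⇒≤ 0<r))

    farBall-isCluster : Far v → IsCluster G r S (farBall v)
    farBall-isCluster {v} far-v = farBall-admissible , maximal
      where
      maximal : ∀ T′ → farBall v ⊆ T′ → Admissible G r S T′ → T′ ≡ farBall v
      maximal T′ ball⊆T′ (farT′ , diamT′) = ⊆-antisym
        (λ {t} t∈T′ → ∈-farBall⁺ (farT′ t t∈T′) (diamT′ v t (ball⊆T′ (center∈farBall far-v)) t∈T′))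
        ball⊆T′

    nonCluster⇒distSetLe : (v : Fin n) → NonCluster G r S v → DistSetLe G v S r
    nonCluster⇒distSetLe v nc with distSetLe? v S r
    ... | yes near = near
    ... | no ¬near = contradiction (farBall v , farBall-isCluster far-v , center∈farBall far-v) nc
      where
      far-v : Far v
      far-v = ¬distSetLe⇒distSetGt ¬near

lemma4 : {n : ℕ} (G : Graph n) (r : ℚ) → 0ℚ < r → (S : Subset n) → IsSPC G r S →
    ((v : Fin n) → NonCluster G r S v → DistSetLe G v S r)
    × ((T : Subset n) → IsCluster G r S T → DiamLe G T r)
    × ((T T' : Subset n) → IsCluster G r S T → IsCluster G r S T' → ¬ (T ≡ T') →
         SetDistGt G T T' (r + r))
lemma4 G r 0<r S spc =
  nonCluster⇒distSetLe , (λ T isCluster → proj₂ (proj₁ isCluster)) , clusters-far-apart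
  where open Clustering G r 0<r S spc
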